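{- Let $G$ be a connected graph on $n\ge 1$ vertices. Then \[ \binom{n+1}{2}\le \mathrm{pn}(G)\le \frac{n!}{2}\sum_{i=0}^{n-1}\frac{1}{i!}+\frac{n}{2}, \] where the lower bound is attained if and only if $G$ is a tree, and the upper bound is attained if and only if $G=K_n$.
   Context: All graphs are finite and simple. For a graph $G$, the subpath number $\mathrm{pn}(G)$ is the number of paths (as subgraphs, i.e. unordered) in $G$, including the trivial paths of length $0$ (single vertices). $K_n$ denotes the complete graph on $n$ vertices. -}

module Defs where

open import Data.Nat using (ℕ; zero; suc; _+_; _<ᵇ_)
open import Data.Nat using (_!)
open import Data.Nat.Properties using (_!≢0)
open import Data.Fin using (Fin; toℕ; _≟_)
open import Data.Bool using (Bool; true; false; _∧_; not)
open import Data.List using (List; []; _∷_; length; filter; concatMap; map; upTo; allFin; last)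
open import Data.Bool.ListAction using (any)
open import Data.Maybe using (Maybe; just; nothing)
open import Data.Product using (Σ; _×_; _,_)
open import Data.Integer using (+_)
open import Data.Rational using (ℚ; _/_; 0ℚ) renaming (_+_ to _+ℚ_; _*_ to _*ℚ_)
open import Relation.Binary.PropositionalEquality using (_≡_; _≢_)
open import Relation.Nullary using (¬_; does)

record Graph (n : ℕ) : Set where
  field
    adj   : Fin n → Fin n → Bool
    sym   : ∀ u v → adj u v ≡ adj v u
    irrefl : ∀ v → adj v v ≡ false
open Graph public

data Walk {n : ℕ} (G : Graph n) : Fin n → Fin n → Set where
  stay : ∀ v → Walk G v v
  step : ∀ {u w v} → adj G u w ≡ true → Walk G w v → Walk G u v

Connected : ∀ {n} → Graph n → Set
Connected G = ∀ u v → Walk G u v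

elemᵇ : ∀ {n} → Fin n → List (Fin n) → Bool
elemᵇ x xs = any (λ y → does (x ≟ y)) xs

distinctᵇ : ∀ {n} → List (Fin n) → Bool
distinctᵇ []       = true
distinctᵇ (x ∷ xs) = not (elemᵇ x xs) ∧ distinctᵇ xs

chainᵇ : ∀ {n} → Graph n → List (Fin n) → Bool
chainᵇ G []           = true
chainᵇ G (x ∷ [])     = true
chainᵇ G (x ∷ y ∷ xs) = adj G x y ∧ chainᵇ G (y ∷ xs)

seqs : (n k : ℕ) → List (List (Fin n))
seqs n zero    = [] ∷ []
seqs n (suc k) = concatMap (λ x → map (x ∷_) (seqs n k)) (allFin n)

-- A path (as an unordered subgraph) with k+1 ≥ 1 vertices is a sequence
-- of distinct vertices v0 … vk with consecutive ones adjacent, taken up to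
-- reversal.  We pick the canonical representative: either a single vertex,
-- or a sequence whose first vertex has smaller index than its last.

canonicalᵇ : ∀ {n} → List (Fin n) → Bool
canonicalᵇ []           = false
canonicalᵇ (x ∷ [])     = true
canonicalᵇ (x ∷ y ∷ xs) with last (y ∷ xs)
... | just z  = toℕ x <ᵇ toℕ z
... | nothing = false

isPathᵇ : ∀ {n} → Graph n → List (Fin n) → Bool
isPathᵇ G xs = distinctᵇ xs ∧ chainᵇ G xs ∧ canonicalᵇ xs

candidates : (n : ℕ) → List (List (Fin n))
candidates n = concatMap (λ k → seqs n (suc k)) (upTo n)

pn : ∀ {n} → Graph n → ℕ
pn {n} G = length (filter (λ xs → isPathᵇ G xs ≡? true) (candidates n))
  where
  open import Data.Bool.Properties using () renaming (_≟_ to _≡?_)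

-- a cycle: distinct vertices v0 … vk with k ≥ 2, consecutive adjacent,
-- and vk adjacent to v0
HasCycle : ∀ {n} → Graph n → Set
HasCycle {n} G =
  Σ (Fin n) λ a → Σ (Fin n) λ b → Σ (Fin n) λ c → Σ (List (Fin n)) λ rest →
  Σ (Fin n) λ z →
    (distinctᵇ (a ∷ b ∷ c ∷ rest) ≡ true) ×
    (chainᵇ G (a ∷ b ∷ c ∷ rest) ≡ true) ×
    (last (c ∷ rest) ≡ just z) × (adj G z a ≡ true)

IsTree : ∀ {n} → Graph n → Set
IsTree G = Connected G × ¬ HasCycle G

IsComplete : ∀ {n} → Graph n → Set
IsComplete G = ∀ u v → u ≢ v → adj G u v ≡ true

invFactSum : ℕ → ℚ
invFactSum zero    = 0ℚ
invFactSum (suc m) = invFactSum m +ℚ _/_ (+ 1) (m !) {{m !≢0}}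

upperBound : ℕ → ℚ
upperBound n = ((+ (n !) / 2) *ℚ invFactSum n) +ℚ (+ n / 2)

module Submission where

-- Fix, for every pair u ≤ v of vertices, one u–v path: these C(n+1,2) paths are distinct because their
-- endpoints are, which gives the lower bound. In an acyclic graph a path is determined by its endpoints (two
-- different u–v paths close a cycle), so trees attain the bound, while a cycle through an edge az yields a second
-- a–z path, so graphs with a cycle exceed it. Every path of G is a path of Kₙ, and a non-edge uv of G is a path of
-- Kₙ only, so pn G ≤ pn Kₙ with equality exactly when G = Kₙ. Finally, there are n!/(n−m)! sequences of m distinct
-- vertices and each path on m ≥ 2 vertices is traced by exactly two of them, so
-- 2·pn(Kₙ) = n + Σ_{m=1}^{n} n!/(n−m)! = n + n!·Σ_{i<n} 1/i!.

open import Defs renaming (sym to adj-sym; irrefl to adj-irrefl)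

open import Data.Bool using (Bool; true; false; _∧_; not; if_then_else_)
open import Data.Bool.Properties
  using (∧-identityʳ; ∧-zeroʳ; ∧-conicalˡ; ∧-conicalʳ; not-injective; not-¬; ¬-not) renaming (_≟_ to _≟ᵇ_)
open import Data.Empty using (⊥; ⊥-elim)
open import Data.Fin using (Fin; toℕ) renaming (zero to fzero; suc to fsuc; _≟_ to _≟ᶠ_)
open import Data.Fin.Properties using (toℕ-injective)
open import Data.Integer as ℤ using (+_)
import Data.Integer.Properties as ℤₚ
import Data.Integer.Solver as ℤ-Solver
open import Data.List
  using (List; []; _∷_; [_]; length; filter; concatMap; map; upTo; allFin; last; _++_; _∷ʳ_; reverse)
open import Data.List.Properties
  using ( length-++; length-map; length-reverse; length-removeAt′; length-tabulate; applyUpTo-∷ʳ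
        ; unfold-reverse; reverse-involutive; ∷-injectiveʳ; ≡-dec)
open import Data.List.Membership.Propositional using (_∈_; _∉_; lose; find)
open import Data.List.Membership.Propositional.Properties
  using ( ∈-++⁺ˡ; ∈-++⁺ʳ; ∈-++⁻; ∈-map⁺; ∈-map⁻; ∈-concatMap⁺; ∈-concatMap⁻; ∈-allFin; ∈-upTo⁺
        ; ∈-filter⁺; ∈-filter⁻; map∷⁻)
open import Data.List.Relation.Binary.Subset.Propositional using (_⊆_)
open import Data.List.Relation.Unary.All as All using (All; []; _∷_)
open import Data.List.Relation.Unary.All.Properties using (¬Any⇒All¬; All¬⇒¬Any)
open import Data.List.Relation.Unary.Any using (here; there; index; _─_; any?)
open import Data.List.Relation.Unary.Any.Properties using (reverse⁻)
open import Data.List.Relation.Unary.Linked as Linked using (Linked; []; [-]; _∷_)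
open import Data.List.Relation.Unary.Unique.Propositional using (Unique; []; _∷_)
import Data.List.Relation.Unary.Unique.Propositional.Properties as Unique
open import Data.Maybe as Maybe using (Maybe; just; nothing)
open import Data.Maybe.Properties using (just-injective)
open import Data.Nat using (ℕ; zero; suc; _+_; _*_; _∸_; _≤_; _<_; z≤n; s≤s; _<ᵇ_; _!; NonZero)
open import Data.Nat.Combinatorics using (_C_; nC1≡n; nCk+nC[k+1]≡[n+1]C[k+1])
open import Data.Nat.Properties
  using ( ≤-refl; ≤-antisym; <⇒≤; <-asym; <-irrefl; <-cmp; ≤∧≢⇒<; ≮⇒≥; m≤n⇒m≤1+n; suc-injective
        ; +-comm; +-assoc; +-suc; +-identityʳ; +-commutativeSemigroup; *-assoc; *-identityˡ; *-identityʳ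
        ; *-zeroʳ; *-distribˡ-+; *-distribʳ-+; +-∸-assoc; m+n∸n≡m; m∸n≤m; m∸[m∸n]≡n; <ᵇ-reflects-<; _!≢0)
open import Algebra.Properties.CommutativeSemigroup +-commutativeSemigroup
  using () renaming (interchange to +-interchange)
open import Data.Product using (Σ; _×_; _,_; proj₁; proj₂)
open import Data.Rational as ℚ using (ℚ; _/_; toℚᵘ; 1ℚ) renaming (_≤_ to _≤ℚ_)
import Data.Rational.Properties as ℚₚ
import Data.Rational.Solver as ℚ-Solver
open import Data.Rational.Unnormalised as ℚᵘ using (mkℚᵘ; *≡*; *≤*) renaming (_≃_ to _≃ᵘ_)
import Data.Rational.Unnormalised.Properties as ℚᵘₚ
open import Data.Sum using (_⊎_; inj₁; inj₂)
open import Function.Base using (case_of_)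
open import Function.Bundles using (_⇔_; mk⇔; Equivalence)
open import Relation.Binary.Definitions using (tri<; tri≈; tri>)
open import Relation.Binary.PropositionalEquality
  using (_≡_; _≢_; refl; sym; trans; cong; cong₂; subst; subst₂; module ≡-Reasoning)
open import Relation.Nullary using (¬_; yes; no; does; ofʸ; ofⁿ)
open import Relation.Nullary.Decidable using (dec-true; dec-false)


𝟙 : Bool → ℕ
𝟙 true  = 1
𝟙 false = 0

module _ {A : Set} where

  ∑ : List A → (A → ℕ) → ℕ
  ∑ []       g = 0
  ∑ (x ∷ xs) g = g x + ∑ xs g

  syntax ∑ xs (λ x → g) = ∑[ x ∈ xs ] g

  countᵇ : (A → Bool) → List A → ℕ
  countᵇ f xs = ∑[ x ∈ xs ] 𝟙 (f x)

  ∑-++ : ∀ xs ys (g : A → ℕ) → ∑ (xs ++ ys) g ≡ ∑ xs g + ∑ ys g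
  ∑-++ []       ys g = refl
  ∑-++ (x ∷ xs) ys g = trans (cong (_+_ (g x)) (∑-++ xs ys g)) (sym (+-assoc (g x) _ _))

  ∑-cong : ∀ xs {g h : A → ℕ} → (∀ x → x ∈ xs → g x ≡ h x) → ∑ xs g ≡ ∑ xs h
  ∑-cong []       e = refl
  ∑-cong (x ∷ xs) e = cong₂ _+_ (e x (here refl)) (∑-cong xs (λ y p → e y (there p)))

  ∑-+ : ∀ xs (g h : A → ℕ) → ∑[ x ∈ xs ] (g x + h x) ≡ ∑ xs g + ∑ xs h
  ∑-+ []       g h = refl
  ∑-+ (x ∷ xs) g h = trans (cong (_+_ (g x + h x)) (∑-+ xs g h)) (+-interchange (g x) (h x) _ _)

  ∑-*ʳ : ∀ xs (g : A → ℕ) c → ∑[ x ∈ xs ] (g x * c) ≡ ∑ xs g * c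
  ∑-*ʳ []       g c = refl
  ∑-*ʳ (x ∷ xs) g c = trans (cong (_+_ (g x * c)) (∑-*ʳ xs g c)) (sym (*-distribʳ-+ c (g x) (∑ xs g)))

  ∑-const : ∀ xs c → ∑[ x ∈ xs ] c ≡ length xs * c
  ∑-const []       c = refl
  ∑-const (x ∷ xs) c = cong (_+_ c) (∑-const xs c)

  length-filter≡countᵇ : ∀ (f : A → Bool) xs → length (filter (λ x → f x ≟ᵇ true) xs) ≡ countᵇ f xs
  length-filter≡countᵇ f []       = refl
  length-filter≡countᵇ f (x ∷ xs) with f x
  ... | true  = cong suc (length-filter≡countᵇ f xs)
  ... | false = length-filter≡countᵇ f xs

  countᵇ-cong : ∀ xs {f g : A → Bool} → (∀ x → x ∈ xs → f x ≡ g x) → countᵇ f xs ≡ countᵇ g xs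
  countᵇ-cong xs e = ∑-cong xs (λ x p → cong 𝟙 (e x p))

  countᵇ-mono : ∀ {f g : A → Bool} → (∀ x → f x ≡ true → g x ≡ true) →
                ∀ xs → countᵇ f xs ≤ countᵇ g xs
  countᵇ-mono             f⇒g []       = z≤n
  countᵇ-mono {f = f} {g} f⇒g (x ∷ xs) with f x in fx | g x in gx
  ... | true  | true  = s≤s (countᵇ-mono f⇒g xs)
  ... | true  | false with () ← trans (sym gx) (f⇒g x fx)
  ... | false | true  = m≤n⇒m≤1+n (countᵇ-mono f⇒g xs)
  ... | false | false = countᵇ-mono f⇒g xs

  countᵇ-mono-< : ∀ {f g : A → Bool} → (∀ x → f x ≡ true → g x ≡ true) →
                  ∀ {y} xs → y ∈ xs → f y ≡ false → g y ≡ true → countᵇ f xs < countᵇ g xs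
  countᵇ-mono-< f⇒g (x ∷ xs) (here refl) fy gy rewrite fy | gy = s≤s (countᵇ-mono f⇒g xs)
  countᵇ-mono-< {f = f} {g} f⇒g (x ∷ xs) (there p) fy gy with f x in fx | g x in gx
  ... | true  | true  = s≤s (countᵇ-mono-< f⇒g xs p fy gy)
  ... | true  | false with () ← trans (sym gx) (f⇒g x fx)
  ... | false | true  = m≤n⇒m≤1+n (countᵇ-mono-< f⇒g xs p fy gy)
  ... | false | false = countᵇ-mono-< f⇒g xs p fy gy

  countᵇ-split : ∀ (f g : A → Bool) xs →
                 countᵇ f xs ≡ countᵇ (λ x → f x ∧ g x) xs + countᵇ (λ x → f x ∧ not (g x)) xs
  countᵇ-split f g []       = refl
  countᵇ-split f g (x ∷ xs) with f x | g x
  ... | true  | true  = cong suc (countᵇ-split f g xs)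
  ... | true  | false = trans (cong suc (countᵇ-split f g xs)) (sym (+-suc _ _))
  ... | false | _     = countᵇ-split f g xs

  countᵇ-not : ∀ (f : A → Bool) xs → countᵇ (λ x → not (f x)) xs + countᵇ f xs ≡ length xs
  countᵇ-not f []       = refl
  countᵇ-not f (x ∷ xs) with f x
  ... | true  = trans (+-suc _ _) (cong suc (countᵇ-not f xs))
  ... | false = cong suc (countᵇ-not f xs)

∑-map : ∀ {A B : Set} (h : A → B) xs (g : B → ℕ) → ∑ (map h xs) g ≡ ∑[ x ∈ xs ] g (h x)
∑-map h []       g = refl
∑-map h (x ∷ xs) g = cong (_+_ (g (h x))) (∑-map h xs g)

∑-concatMap : ∀ {A B : Set} (h : A → List B) xs (g : B → ℕ) →
              ∑ (concatMap h xs) g ≡ ∑[ x ∈ xs ] ∑ (h x) g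
∑-concatMap h []       g = refl
∑-concatMap h (x ∷ xs) g = trans (∑-++ (h x) (concatMap h xs) g) (cong (_+_ (∑ (h x) g)) (∑-concatMap h xs g))

∑-comm : ∀ {A B : Set} xs ys (g : A → B → ℕ) →
         ∑[ x ∈ xs ] ∑[ y ∈ ys ] g x y ≡ ∑[ y ∈ ys ] ∑[ x ∈ xs ] g x y
∑-comm []       ys g = sym (trans (∑-const ys 0) (*-zeroʳ (length ys)))
∑-comm (x ∷ xs) ys g =
  trans (cong (_+_ (∑ ys (g x))) (∑-comm xs ys g)) (sym (∑-+ ys (g x) (λ y → ∑[ x ∈ xs ] g x y)))

∑< : ℕ → (ℕ → ℕ) → ℕ
∑< zero    g = 0
∑< (suc m) g = ∑< m g + g m

syntax ∑< m (λ i → g) = ∑[ i < m ] g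

∑-upTo : ∀ m (g : ℕ → ℕ) → ∑[ i ∈ upTo m ] g i ≡ ∑[ i < m ] g i
∑-upTo zero    g = refl
∑-upTo (suc m) g = begin
  ∑ (upTo (suc m)) g          ≡⟨ cong (λ is → ∑ is g) (sym (applyUpTo-∷ʳ (λ i → i) m)) ⟩
  ∑ (upTo m ++ [ m ]) g       ≡⟨ ∑-++ (upTo m) [ m ] g ⟩
  ∑ (upTo m) g + (g m + 0)    ≡⟨ cong₂ _+_ (∑-upTo m g) (+-identityʳ (g m)) ⟩
  ∑[ i < m ] g i + g m        ∎
  where open ≡-Reasoning

∑<-cong : ∀ m {g h : ℕ → ℕ} → (∀ i → i < m → g i ≡ h i) → ∑[ i < m ] g i ≡ ∑[ i < m ] h i
∑<-cong zero    e = refl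
∑<-cong (suc m) e = cong₂ _+_ (∑<-cong m (λ i i<m → e i (m≤n⇒m≤1+n i<m))) (e m ≤-refl)

∑<-suc : ∀ m (g : ℕ → ℕ) → ∑[ i < suc m ] g i ≡ g 0 + ∑[ i < m ] g (suc i)
∑<-suc zero    g = +-comm 0 (g 0)
∑<-suc (suc m) g = trans (cong (_+ g (suc m)) (∑<-suc m g)) (+-assoc (g 0) _ _)

∑<-reflect : ∀ m (g : ℕ → ℕ) → ∑[ i < m ] g (m ∸ i) ≡ ∑[ i < m ] g (suc i)
∑<-reflect zero    g = refl
∑<-reflect (suc m) g = begin
  ∑[ i < m ] g (suc m ∸ i) + g (suc m ∸ m)
    ≡⟨ cong₂ _+_ (∑<-cong m (λ i i<m → cong g (+-∸-assoc 1 (<⇒≤ i<m)))) (cong g (m+n∸n≡m 1 m)) ⟩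
  ∑[ i < m ] g (suc (m ∸ i)) + g 1           ≡⟨ cong (_+ g 1) (∑<-reflect m (λ k → g (suc k))) ⟩
  ∑[ i < m ] g (suc (suc i)) + g 1           ≡⟨ +-comm _ (g 1) ⟩
  g 1 + ∑[ i < m ] g (suc (suc i))           ≡⟨ sym (∑<-suc m (λ k → g (suc k))) ⟩
  ∑[ i < suc m ] g (suc i)                   ∎
  where open ≡-Reasoning


module _ {A : Set} where

  ∈-─ : ∀ {x z : A} {ys} (x∈ys : x ∈ ys) → z ∈ ys → z ≢ x → z ∈ (ys ─ x∈ys)
  ∈-─ (here refl) (here refl) z≢x = ⊥-elim (z≢x refl)
  ∈-─ (here refl) (there z∈ys) _  = z∈ys
  ∈-─ (there _)   (here refl) _   = here refl
  ∈-─ (there x∈ys) (there z∈ys) z≢x = there (∈-─ x∈ys z∈ys z≢x)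

  Unique-⊆⇒length≤ : ∀ {xs ys : List A} → Unique xs → xs ⊆ ys → length xs ≤ length ys
  Unique-⊆⇒length≤ {[]}     _              _     = z≤n
  Unique-⊆⇒length≤ {x ∷ xs} {ys} (x≢xs ∷ u) xs⊆ys =
    subst (suc (length xs) ≤_) (sym (length-removeAt′ ys (index x∈ys)))
      (s≤s (Unique-⊆⇒length≤ u (λ z∈xs → ∈-─ x∈ys (xs⊆ys (there z∈xs)) (z≢x z∈xs))))
    where
    x∈ys = xs⊆ys (here refl)
    z≢x : ∀ {z} → z ∈ xs → z ≢ x
    z≢x z∈xs refl = All.lookup x≢xs z∈xs refl

  Unique-map⁺-on : ∀ {B : Set} (f : A → B) {xs} → Unique xs →
                   (∀ {x y} → x ∈ xs → y ∈ xs → f x ≡ f y → x ≡ y) → Unique (map f xs)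
  Unique-map⁺-on f {[]}     []           inj = []
  Unique-map⁺-on f {x ∷ xs} (x≢xs ∷ u) inj =
    map-≢ x≢xs (λ y∈ → y∈) ∷ Unique-map⁺-on f u (λ p q → inj (there p) (there q))
    where
    map-≢ : ∀ {ys} → All (x ≢_) ys → ys ⊆ xs → All (f x ≢_) (map f ys)
    map-≢ []           _     = []
    map-≢ (x≢y ∷ x≢ys) ys⊆xs =
      (λ fx≡fy → x≢y (inj (here refl) (there (ys⊆xs (here refl))) fx≡fy)) ∷ map-≢ x≢ys (λ p → ys⊆xs (there p))

  Unique-concatMap⁺ : ∀ {B : Set} {f : A → List B} → (∀ x → Unique (f x)) →
                      (∀ {x y z} → z ∈ f x → z ∈ f y → x ≡ y) → ∀ {xs} → Unique xs → Unique (concatMap f xs)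
  Unique-concatMap⁺         uf inj {[]}     []         = []
  Unique-concatMap⁺ {f = f} uf inj {x ∷ xs} (x≢xs ∷ u) =
    Unique.++⁺ (uf x) (Unique-concatMap⁺ uf inj u)
      λ (z∈fx , z∈rest) → let x≢y , z∈fy = All.lookupAny x≢xs (∈-concatMap⁻ f z∈rest) in x≢y (inj z∈fx z∈fy)

  countᵇ-∘-involution≤ : ∀ (σ : A → A) → (∀ x → σ (σ x) ≡ x) → ∀ {xs} → Unique xs →
                         (∀ {x} → x ∈ xs → σ x ∈ xs) → ∀ f → countᵇ (λ x → f (σ x)) xs ≤ countᵇ f xs
  countᵇ-∘-involution≤ σ σσ {xs} u closed f =
    subst₂ _≤_ (trans (length-map σ (filter P? xs)) (length-filter≡countᵇ (λ x → f (σ x)) xs))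
               (length-filter≡countᵇ f xs)
      (Unique-⊆⇒length≤ (Unique.map⁺ σ-injective (Unique.filter⁺ P? u)) σ-filter⊆)
    where
    P? = λ x → f (σ x) ≟ᵇ true
    σ-injective : ∀ {x y} → σ x ≡ σ y → x ≡ y
    σ-injective {x} {y} eq = trans (sym (σσ x)) (trans (cong σ eq) (σσ y))
    σ-filter⊆ : map σ (filter P? xs) ⊆ filter (λ x → f x ≟ᵇ true) xs
    σ-filter⊆ y∈ with ∈-map⁻ σ y∈
    ... | x , x∈ , refl with ∈-filter⁻ P? {xs = xs} x∈
    ...   | x∈xs , fσx = ∈-filter⁺ (λ x → f x ≟ᵇ true) (closed x∈xs) fσx

  countᵇ-∘-involution : ∀ (σ : A → A) → (∀ x → σ (σ x) ≡ x) → ∀ {xs} → Unique xs →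
                        (∀ {x} → x ∈ xs → σ x ∈ xs) → ∀ f → countᵇ (λ x → f (σ x)) xs ≡ countᵇ f xs
  countᵇ-∘-involution σ σσ {xs} u closed f = ≤-antisym (countᵇ-∘-involution≤ σ σσ u closed f)
    (subst (_≤ countᵇ (λ x → f (σ x)) xs) (countᵇ-cong xs (λ x _ → cong f (σσ x)))
      (countᵇ-∘-involution≤ σ σσ u closed (λ x → f (σ x))))


module _ {A : Set} where

  last-∈ : ∀ {z : A} xs → last xs ≡ just z → z ∈ xs
  last-∈ (x ∷ [])     refl = here refl
  last-∈ (x ∷ y ∷ ys) l    = there (last-∈ (y ∷ ys) l)

  last-∷ : ∀ (x : A) xs → Σ A λ z → last (x ∷ xs) ≡ just z
  last-∷ x []       = x , refl
  last-∷ x (y ∷ ys) = last-∷ y ys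

  last-∷ʳ : ∀ (xs : List A) y → last (xs ∷ʳ y) ≡ just y
  last-∷ʳ []            y = refl
  last-∷ʳ (x ∷ [])      y = refl
  last-∷ʳ (x ∷ x′ ∷ xs) y = last-∷ʳ (x′ ∷ xs) y

  last-reverse : ∀ (x : A) xs → last (reverse (x ∷ xs)) ≡ just x
  last-reverse x xs rewrite unfold-reverse x xs = last-∷ʳ (reverse xs) x

  reverse-last : ∀ (xs : List A) {z} → last xs ≡ just z → Σ (List A) λ ws → reverse xs ≡ z ∷ ws
  reverse-last (x ∷ [])     refl = [] , refl
  reverse-last (x ∷ y ∷ ys) l with reverse-last (y ∷ ys) l
  ... | ws , eq = ws ∷ʳ x , trans (unfold-reverse x (y ∷ ys)) (cong (_∷ʳ x) eq)

  head≢last : ∀ {x z : A} {xs} → Unique (x ∷ xs) → last xs ≡ just z → x ≢ z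
  head≢last (x≢xs ∷ _) l refl = All¬⇒¬Any x≢xs (last-∈ _ l)

  Unique-reverse : ∀ {xs : List A} → Unique xs → Unique (reverse xs)
  Unique-reverse {[]}     []         = []
  Unique-reverse {x ∷ xs} (x≢xs ∷ u) = subst Unique (sym (unfold-reverse x xs))
    (Unique.++⁺ (Unique-reverse u) ([] ∷ []) λ { (x∈ , here refl) → All¬⇒¬Any x≢xs (reverse⁻ x∈) })

  Linked-∷ʳ : ∀ {R : A → A → Set} {xs x y} → Linked R xs → last xs ≡ just x → R x y → Linked R (xs ∷ʳ y)
  Linked-∷ʳ [-]       refl Rxy = Rxy ∷ [-]
  Linked-∷ʳ (Rab ∷ l) l≡x  Rxy = Rab ∷ Linked-∷ʳ l l≡x Rxy

  Linked-reverse : ∀ {R : A → A → Set} → (∀ {x y} → R x y → R y x) →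
                   ∀ {xs} → Linked R xs → Linked R (reverse xs)
  Linked-reverse R-sym []              = []
  Linked-reverse R-sym [-]             = [-]
  Linked-reverse {R} R-sym {x ∷ y ∷ ys} (Rxy ∷ l) = subst (Linked R) (sym (unfold-reverse x (y ∷ ys)))
    (Linked-∷ʳ (Linked-reverse R-sym l) (last-reverse y ys) (R-sym Rxy))


∧-intro : ∀ {a b} → a ≡ true → b ≡ true → a ∧ b ≡ true
∧-intro refl refl = refl

<ᵇ-flip : ∀ {m n} → m ≢ n → (n <ᵇ m) ≡ not (m <ᵇ n)
<ᵇ-flip {m} {n} m≢n with m <ᵇ n | <ᵇ-reflects-< m n | n <ᵇ m | <ᵇ-reflects-< n m
... | true  | ofʸ m<n | true  | ofʸ n<m = ⊥-elim (<-asym m<n n<m)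
... | true  | _       | false | _       = refl
... | false | _       | true  | _       = refl
... | false | ofⁿ m≮n | false | ofⁿ n≮m = ⊥-elim (n≮m (≤∧≢⇒< (≮⇒≥ m≮n) λ n≡m → m≢n (sym n≡m)))

module _ {n : ℕ} where

  elemᵇ⇒∈ : ∀ {x : Fin n} xs → elemᵇ x xs ≡ true → x ∈ xs
  elemᵇ⇒∈ {x} (y ∷ ys) e with x ≟ᶠ y
  ... | yes refl = here refl
  ... | no _     = there (elemᵇ⇒∈ ys e)

  ∈⇒elemᵇ : ∀ {x : Fin n} {xs} → x ∈ xs → elemᵇ x xs ≡ true
  ∈⇒elemᵇ {x} {y ∷ ys} x∈ with x ≟ᶠ y | x∈
  ... | yes _  | _          = refl
  ... | no x≢y | here x≡y   = ⊥-elim (x≢y x≡y)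
  ... | no _   | there x∈ys = ∈⇒elemᵇ x∈ys

  distinctᵇ⇒Unique : ∀ xs → distinctᵇ xs ≡ true → Unique xs
  distinctᵇ⇒Unique []       _ = []
  distinctᵇ⇒Unique (x ∷ xs) d =
    ¬Any⇒All¬ xs (λ x∈xs → not-¬ (∈⇒elemᵇ x∈xs) (not-injective (∧-conicalˡ _ _ d)))
      ∷ distinctᵇ⇒Unique xs (∧-conicalʳ _ _ d)

  Unique⇒distinctᵇ : ∀ {xs} → Unique xs → distinctᵇ xs ≡ true
  Unique⇒distinctᵇ {[]}     []         = refl
  Unique⇒distinctᵇ {x ∷ xs} (x≢xs ∷ u) =
    ∧-intro (cong not (¬-not (λ e → All¬⇒¬Any x≢xs (elemᵇ⇒∈ xs e)))) (Unique⇒distinctᵇ u)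

  Unique⇒length≤ : ∀ {xs : List (Fin n)} → Unique xs → length xs ≤ n
  Unique⇒length≤ {xs} u = subst (length xs ≤_) (length-tabulate {n = n} (λ i → i))
    (Unique-⊆⇒length≤ u (λ {z} _ → ∈-allFin z))

  ends : List (Fin n) → Maybe (Fin n × Fin n)
  ends []       = nothing
  ends (x ∷ xs) = Maybe.map (x ,_) (last (x ∷ xs))

  ends-∷ : ∀ x xs {z} → last (x ∷ xs) ≡ just z → ends (x ∷ xs) ≡ just (x , z)
  ends-∷ x xs l = cong (Maybe.map (x ,_)) l

  ends-reverse : ∀ xs {x z : Fin n} → ends xs ≡ just (x , z) → ends (reverse xs) ≡ just (z , x)
  ends-reverse (x ∷ xs) e with last (x ∷ xs) in l | e
  ... | just z | refl with reverse-last (x ∷ xs) l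
  ...   | ws , r rewrite r = ends-∷ z ws (subst (λ rs → last rs ≡ just x) r (last-reverse x xs))

  canonicalᵇ-∷∷ : ∀ x y ys {z : Fin n} → last (y ∷ ys) ≡ just z →
                  canonicalᵇ (x ∷ y ∷ ys) ≡ (toℕ x <ᵇ toℕ z)
  canonicalᵇ-∷∷ x y ys l rewrite l = refl

  canonicalᵇ⇔≤ : ∀ x xs {z : Fin n} → Unique (x ∷ xs) → last (x ∷ xs) ≡ just z →
                 (canonicalᵇ (x ∷ xs) ≡ true) ⇔ (toℕ x ≤ toℕ z)
  canonicalᵇ⇔≤ x []       u refl = mk⇔ (λ _ → ≤-refl) (λ _ → refl)
  canonicalᵇ⇔≤ x (y ∷ ys) {z} u l rewrite canonicalᵇ-∷∷ x y ys l
    with toℕ x <ᵇ toℕ z | <ᵇ-reflects-< (toℕ x) (toℕ z)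
  ... | true  | ofʸ x<z = mk⇔ (λ _ → <⇒≤ x<z) (λ _ → refl)
  ... | false | ofⁿ x≮z = mk⇔ (λ ()) λ x≤z → ⊥-elim (x≮z (≤∧≢⇒< x≤z λ x≡z → head≢last u l (toℕ-injective x≡z)))

  canonicalᵇ-reverse : ∀ {xs : List (Fin n)} → Unique xs → 2 ≤ length xs →
                       canonicalᵇ (reverse xs) ≡ not (canonicalᵇ xs)
  canonicalᵇ-reverse {x ∷ []}     _        (s≤s ())
  canonicalᵇ-reverse {x ∷ y ∷ ys} u        _ with last-∷ y ys
  ... | z , l with reverse-last (x ∷ y ∷ ys) l
  ... | [] , r with () ← trans (sym (length-reverse (x ∷ y ∷ ys))) (cong length r)
  ... | w ∷ ws , r rewrite r = begin
    canonicalᵇ (z ∷ w ∷ ws)        ≡⟨ canonicalᵇ-∷∷ z w ws last≡x ⟩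
    toℕ z <ᵇ toℕ x                 ≡⟨ <ᵇ-flip (λ x≡z → head≢last u l (toℕ-injective x≡z)) ⟩
    not (toℕ x <ᵇ toℕ z)           ≡⟨ cong not (canonicalᵇ-∷∷ x y ys l) ⟨
    not (canonicalᵇ (x ∷ y ∷ ys))  ∎
    where
    open ≡-Reasoning
    last≡x : last (w ∷ ws) ≡ just x
    last≡x = subst (λ rs → last rs ≡ just x) r (last-reverse x (y ∷ ys))


-- Walks and paths

Adj : ∀ {n} → Graph n → Fin n → Fin n → Set
Adj G u v = adj G u v ≡ true

_⊆ᴳ_ : ∀ {n} → Graph n → Graph n → Set
G ⊆ᴳ H = ∀ {u v} → Adj G u v → Adj H u v

module _ {n : ℕ} (G : Graph n) where

  Adj-sym : ∀ {u v} → Adj G u v → Adj G v u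
  Adj-sym {u} {v} = trans (adj-sym G v u)

  chainᵇ⇒Linked : ∀ xs → chainᵇ G xs ≡ true → Linked (Adj G) xs
  chainᵇ⇒Linked []           _ = []
  chainᵇ⇒Linked (x ∷ [])     _ = [-]
  chainᵇ⇒Linked (x ∷ y ∷ ys) c = ∧-conicalˡ _ _ c ∷ chainᵇ⇒Linked (y ∷ ys) (∧-conicalʳ _ _ c)

  Linked⇒chainᵇ : ∀ {xs} → Linked (Adj G) xs → chainᵇ G xs ≡ true
  Linked⇒chainᵇ []      = refl
  Linked⇒chainᵇ [-]     = refl
  Linked⇒chainᵇ (a ∷ l) = ∧-intro a (Linked⇒chainᵇ l)

  IsPath : List (Fin n) → Set
  IsPath xs = Unique xs × Linked (Adj G) xs

  isPathᵇ⇒ : ∀ xs → isPathᵇ G xs ≡ true → IsPath xs × canonicalᵇ xs ≡ true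
  isPathᵇ⇒ xs e = (distinctᵇ⇒Unique xs (∧-conicalˡ _ _ e) , chainᵇ⇒Linked xs (∧-conicalˡ _ _ rest)) ,
                  ∧-conicalʳ _ _ rest
    where rest = ∧-conicalʳ (distinctᵇ xs) _ e

  isPathᵇ⇐ : ∀ {xs} → IsPath xs → canonicalᵇ xs ≡ true → isPathᵇ G xs ≡ true
  isPathᵇ⇐ (u , l) k = ∧-intro (Unique⇒distinctᵇ u) (∧-intro (Linked⇒chainᵇ l) k)

  vertices : ∀ {u v} → Walk G u v → List (Fin n)
  vertices (stay v)       = [ v ]
  vertices (step {u} _ W) = u ∷ vertices W

  _++ʷ_ : ∀ {u v w} → Walk G u v → Walk G v w → Walk G u w
  stay _   ++ʷ W₂ = W₂
  step a W ++ʷ W₂ = step a (W ++ʷ W₂)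

  ∈-vertices-++ʷ⁻ : ∀ {u v w z} (W₁ : Walk G u v) (W₂ : Walk G v w) →
                    z ∈ vertices (W₁ ++ʷ W₂) → z ∈ vertices W₁ ⊎ z ∈ vertices W₂
  ∈-vertices-++ʷ⁻ (stay _)   W₂ z∈            = inj₂ z∈
  ∈-vertices-++ʷ⁻ (step a W) W₂ (here refl)   = inj₁ (here refl)
  ∈-vertices-++ʷ⁻ (step a W) W₂ (there z∈) with ∈-vertices-++ʷ⁻ W W₂ z∈
  ... | inj₁ z∈W  = inj₁ (there z∈W)
  ... | inj₂ z∈W₂ = inj₂ z∈W₂

  reverseʷ : ∀ {u v} → Walk G u v → Walk G v u
  reverseʷ (stay v)   = stay v
  reverseʷ (step a W) = reverseʷ W ++ʷ step (Adj-sym a) (stay _)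

  head∈vertices : ∀ {u v} (W : Walk G u v) → u ∈ vertices W
  head∈vertices (stay _)   = here refl
  head∈vertices (step _ _) = here refl

  vertices-reverseʷ : ∀ {u v} (W : Walk G u v) → vertices (reverseʷ W) ⊆ vertices W
  vertices-reverseʷ (stay v)   z∈ = z∈
  vertices-reverseʷ (step a W) z∈ with ∈-vertices-++ʷ⁻ (reverseʷ W) (step (Adj-sym a) (stay _)) z∈
  ... | inj₁ z∈W                 = there (vertices-reverseʷ W z∈W)
  ... | inj₂ (here refl)         = there (head∈vertices W)
  ... | inj₂ (there (here refl)) = here refl

  Linked⇒Walk : ∀ u ys {v} → Linked (Adj G) (u ∷ ys) → last (u ∷ ys) ≡ just v →
                Σ (Walk G u v) λ W → vertices W ⊆ u ∷ ys
  Linked⇒Walk u []       _       refl = stay u , λ z∈ → z∈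
  Linked⇒Walk u (y ∷ ys) (a ∷ l) l≡v with Linked⇒Walk y ys l l≡v
  ... | W , W⊆ = step a W , λ { (here refl) → here refl ; (there z∈) → there (W⊆ z∈) }

  record Path (u v : Fin n) (S : List (Fin n)) : Set where
    field
      inner  : List (Fin n)
      isPath : IsPath (u ∷ inner)
      to     : last (u ∷ inner) ≡ just v
      within : u ∷ inner ⊆ S

  suffix : ∀ {x v} R → x ∈ R → IsPath R → last R ≡ just v → Path x v R
  suffix (y ∷ R) (here refl) p to = record { inner = R ; isPath = p ; to = to ; within = λ z∈ → z∈ }
  suffix (y ∷ R@(_ ∷ _)) (there x∈R) ((_ ∷ u) , l) to with suffix R x∈R (u , Linked.tail l) to
  ... | record { inner = B ; isPath = p ; to = to′ ; within = within } =
    record { inner = B ; isPath = p ; to = to′ ; within = λ z∈ → there (within z∈) }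

  -- Prepending u to a path from w either gives a path, or u already lies on it and we cut the path short there.
  extend : ∀ {u w v S} → Adj G u w → Path w v S → Path u v (u ∷ S)
  extend {u} {w} a record { inner = R ; isPath = u-R , l-R ; to = to ; within = within } with any? (u ≟ᶠ_) (w ∷ R)
  ... | no u∉ = record { inner = w ∷ R ; isPath = ¬Any⇒All¬ _ u∉ ∷ u-R , a ∷ l-R ; to = to
                       ; within = λ { (here refl) → here refl ; (there z∈) → there (within z∈) } }
  ... | yes u∈ with suffix (w ∷ R) u∈ (u-R , l-R) to
  ...   | record { inner = B ; isPath = p ; to = to′ ; within = within′ } =
    record { inner = B ; isPath = p ; to = to′ ; within = λ z∈ → there (within (within′ z∈)) }

  walk⇒path : ∀ {u v} (W : Walk G u v) → Path u v (vertices W)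
  walk⇒path (stay v)   = record { inner = [] ; isPath = [] ∷ [] , [-] ; to = refl ; within = λ z∈ → z∈ }
  walk⇒path (step a W) = extend a (walk⇒path W)

  twoPaths⇒cycle : ∀ x xs ys {z} → IsPath (x ∷ xs) → last (x ∷ xs) ≡ just z →
                   IsPath (x ∷ ys) → last (x ∷ ys) ≡ just z → xs ≢ ys → HasCycle G
  twoPaths⇒cycle x []       []       _       _    _       _    xs≢ys = ⊥-elim (xs≢ys refl)
  twoPaths⇒cycle x []       (q ∷ ys) _       refl (u , _) to₂  _     = ⊥-elim (head≢last u to₂ refl)
  twoPaths⇒cycle x (p ∷ xs) []       (u , _) to₁  _       refl _     = ⊥-elim (head≢last u to₁ refl)
  twoPaths⇒cycle x (p ∷ xs) (q ∷ ys) (x≢xs ∷ u₁ , a₁ ∷ l₁) to₁ (x≢ys ∷ u₂ , a₂ ∷ l₂) to₂ xs≢ys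
    with p ≟ᶠ q
  ... | yes refl = twoPaths⇒cycle p xs ys (u₁ , l₁) to₁ (u₂ , l₂) to₂ (λ xs≡ys → xs≢ys (cong (p ∷_) xs≡ys))
  ... | no p≢q with Linked⇒Walk p xs l₁ to₁ | Linked⇒Walk q ys l₂ to₂
  ...   | W₁ , W₁⊆ | W₂ , W₂⊆ with walk⇒path (W₁ ++ʷ reverseʷ W₂)
  ...     | record { inner = [] ; to = refl } = ⊥-elim (p≢q refl)
  ...     | record { inner = c ∷ rest ; isPath = u , l ; to = to ; within = within } =
    x , p , c , rest , q , Unique⇒distinctᵇ (¬Any⇒All¬ _ x∉ ∷ u) , Linked⇒chainᵇ (a₁ ∷ l) , to , Adj-sym a₂
    where
    x∉ : x ∉ p ∷ c ∷ rest
    x∉ x∈ with ∈-vertices-++ʷ⁻ W₁ (reverseʷ W₂) (within x∈)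
    ... | inj₁ x∈W₁ = All¬⇒¬Any x≢xs (W₁⊆ x∈W₁)
    ... | inj₂ x∈W₂ = All¬⇒¬Any x≢ys (W₂⊆ (vertices-reverseʷ W₂ x∈W₂))


module _ {n : ℕ} where

  ∈-seqs : ∀ (xs : List (Fin n)) → xs ∈ seqs n (length xs)
  ∈-seqs []       = here refl
  ∈-seqs (x ∷ xs) = ∈-concatMap⁺ _ (lose (∈-allFin x) (∈-map⁺ (x ∷_) (∈-seqs xs)))

  ∈-seqs⇒length : ∀ k {xs : List (Fin n)} → xs ∈ seqs n k → length xs ≡ k
  ∈-seqs⇒length zero    (here refl) = refl
  ∈-seqs⇒length (suc k) xs∈ with find (∈-concatMap⁻ (λ x → map (x ∷_) (seqs n k)) {allFin n} xs∈)
  ... | x , _ , xs∈x∷ with map∷⁻ xs∈x∷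
  ...   | ys , ys∈ , refl = cong suc (∈-seqs⇒length k ys∈)

  ∈-seqs-reverse : ∀ k {xs : List (Fin n)} → xs ∈ seqs n k → reverse xs ∈ seqs n k
  ∈-seqs-reverse k {xs} xs∈ =
    subst (λ m → reverse xs ∈ seqs n m) (trans (length-reverse xs) (∈-seqs⇒length k xs∈)) (∈-seqs (reverse xs))

  Unique-seqs : ∀ k → Unique (seqs n k)
  Unique-seqs zero    = [] ∷ []
  Unique-seqs (suc k) = Unique-concatMap⁺ (λ _ → Unique.map⁺ ∷-injectiveʳ (Unique-seqs k)) same-head (Unique.allFin⁺ n)
    where
    same-head : ∀ {x y : Fin n} {zs} → zs ∈ map (x ∷_) (seqs n k) → zs ∈ map (y ∷_) (seqs n k) → x ≡ y
    same-head zs∈x zs∈y with map∷⁻ zs∈x | map∷⁻ zs∈y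
    ... | _ , _ , refl | _ , _ , refl = refl

  ∈-candidates : ∀ x (xs : List (Fin n)) → length (x ∷ xs) ≤ n → x ∷ xs ∈ candidates n
  ∈-candidates x xs len≤n = ∈-concatMap⁺ _ (lose (∈-upTo⁺ len≤n) (∈-seqs (x ∷ xs)))

  Unique-candidates : Unique (candidates n)
  Unique-candidates = Unique-concatMap⁺ (λ k → Unique-seqs (suc k)) same-length (Unique.upTo⁺ n)
    where
    same-length : ∀ {k l} {zs : List (Fin n)} → zs ∈ seqs n (suc k) → zs ∈ seqs n (suc l) → k ≡ l
    same-length {k} {l} zs∈k zs∈l =
      suc-injective (trans (sym (∈-seqs⇒length (suc k) zs∈k)) (∈-seqs⇒length (suc l) zs∈l))

pairWithZero : ∀ {n} → Fin (suc n) → Fin (suc n) × Fin (suc n)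
pairWithZero v = fzero , v

sucPair : ∀ {n} → Fin n × Fin n → Fin (suc n) × Fin (suc n)
sucPair (u , v) = fsuc u , fsuc v

orderedPairs : ∀ n → List (Fin n × Fin n)
orderedPairs zero    = []
orderedPairs (suc n) = map pairWithZero (allFin (suc n)) ++ map sucPair (orderedPairs n)

∈-orderedPairs⁺ : ∀ n {u v : Fin n} → toℕ u ≤ toℕ v → (u , v) ∈ orderedPairs n
∈-orderedPairs⁺ (suc n) {fzero}  {v}      _         = ∈-++⁺ˡ (∈-map⁺ pairWithZero (∈-allFin v))
∈-orderedPairs⁺ (suc n) {fsuc u} {fsuc v} (s≤s u≤v) =
  ∈-++⁺ʳ (map pairWithZero (allFin (suc n))) (∈-map⁺ sucPair (∈-orderedPairs⁺ n u≤v))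

∈-orderedPairs⁻ : ∀ n {u v : Fin n} → (u , v) ∈ orderedPairs n → toℕ u ≤ toℕ v
∈-orderedPairs⁻ (suc n) uv∈ with ∈-++⁻ (map pairWithZero (allFin (suc n))) uv∈
... | inj₁ uv∈₀ with ∈-map⁻ pairWithZero uv∈₀
...   | _ , _ , refl = z≤n
∈-orderedPairs⁻ (suc n) uv∈ | inj₂ uv∈₊ with ∈-map⁻ sucPair uv∈₊
...   | _ , uv∈′ , refl = s≤s (∈-orderedPairs⁻ n uv∈′)

length-orderedPairs : ∀ n → length (orderedPairs n) ≡ suc n C 2
length-orderedPairs zero    = refl
length-orderedPairs (suc n) = begin
  length (orderedPairs (suc n))                  ≡⟨ length-++ (map pairWithZero (allFin (suc n))) ⟩
  length (map pairWithZero (allFin (suc n))) + length (map sucPair (orderedPairs n))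
    ≡⟨ cong₂ _+_ (trans (length-map _ (allFin (suc n))) (length-tabulate {n = suc n} (λ i → i)))
                 (trans (length-map _ (orderedPairs n)) (length-orderedPairs n)) ⟩
  suc n + suc n C 2                              ≡⟨ cong (_+ suc n C 2) (sym (nC1≡n (suc n))) ⟩
  suc n C 1 + suc n C 2                          ≡⟨ nCk+nC[k+1]≡[n+1]C[k+1] (suc n) 1 ⟩
  suc (suc n) C 2                                ∎
  where open ≡-Reasoning

Unique-orderedPairs : ∀ n → Unique (orderedPairs n)
Unique-orderedPairs zero    = []
Unique-orderedPairs (suc n) =
  Unique.++⁺ (Unique.map⁺ (λ { refl → refl }) (Unique.allFin⁺ (suc n)))
             (Unique.map⁺ (λ { {_ , _} {_ , _} refl → refl }) (Unique-orderedPairs n))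
             λ (p∈₀ , p∈₊) → zero≢suc p∈₀ p∈₊
  where
  zero≢suc : ∀ {p : Fin (suc n) × Fin (suc n)} → p ∈ map pairWithZero (allFin (suc n)) →
             p ∈ map sucPair (orderedPairs n) → ⊥
  zero≢suc p∈₀ p∈₊ with ∈-map⁻ _ p∈₀ | ∈-map⁻ _ p∈₊
  ... | _ , _ , refl | _ , _ , ()


-- The paths of a graph: lower bound, trees and cycles

module _ {n : ℕ} where

  canonicalize : List (Fin n) → List (Fin n)
  canonicalize xs = if canonicalᵇ xs then xs else reverse xs

  length-canonicalize : ∀ xs → length (canonicalize xs) ≡ length xs
  length-canonicalize xs with canonicalᵇ xs
  ... | true  = refl
  ... | false = length-reverse xs

  ends-canonicalize : ∀ xs ys {x z} → canonicalᵇ xs ≡ canonicalᵇ ys →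
                      ends xs ≡ just (x , z) → ends ys ≡ just (x , z) →
                      ends (canonicalize xs) ≡ ends (canonicalize ys)
  ends-canonicalize xs ys same e₁ e₂ with canonicalᵇ xs | canonicalᵇ ys | same
  ... | true  | true  | refl = trans e₁ (sym e₂)
  ... | false | false | refl = trans (ends-reverse xs e₁) (sym (ends-reverse ys e₂))

module _ {n : ℕ} (G : Graph n) where

  paths : List (List (Fin n))
  paths = filter (λ xs → isPathᵇ G xs ≟ᵇ true) (candidates n)

  ∈-paths⁺ : ∀ {xs} → IsPath G xs → canonicalᵇ xs ≡ true → xs ∈ paths
  ∈-paths⁺ {x ∷ xs} p k = ∈-filter⁺ _ (∈-candidates x xs (Unique⇒length≤ (proj₁ p))) (isPathᵇ⇐ G p k)

  ∈-paths⁻ : ∀ {xs} → xs ∈ paths → IsPath G xs × canonicalᵇ xs ≡ true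
  ∈-paths⁻ {xs} xs∈ = isPathᵇ⇒ G xs (proj₂ (∈-filter⁻ _ {xs = candidates n} xs∈))

  Unique-paths : Unique paths
  Unique-paths = Unique.filter⁺ _ Unique-candidates

  []∉paths : [] ∉ paths
  []∉paths []∈ with () ← proj₂ (∈-paths⁻ []∈)

  ends-paths : ∀ {xs} → xs ∈ paths → Σ (Fin n × Fin n) λ e → ends xs ≡ just e × e ∈ orderedPairs n
  ends-paths {[]}     []∈ = ⊥-elim ([]∉paths []∈)
  ends-paths {x ∷ xs} xs∈ with last-∷ x xs | ∈-paths⁻ xs∈
  ... | z , l | (u , _) , k = (x , z) , ends-∷ x xs l , ∈-orderedPairs⁺ n (Equivalence.to (canonicalᵇ⇔≤ x xs u l) k)

  acyclic⇒ends-injective : ¬ HasCycle G → ∀ {xs ys} → xs ∈ paths → ys ∈ paths → ends xs ≡ ends ys → xs ≡ ys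
  acyclic⇒ends-injective acyclic {[]}            []∈ _   _ = ⊥-elim ([]∉paths []∈)
  acyclic⇒ends-injective acyclic {_ ∷ _} {[]}     _   []∈ _ = ⊥-elim ([]∉paths []∈)
  acyclic⇒ends-injective acyclic {x ∷ xs} {y ∷ ys} xs∈ ys∈ same-ends
    with last-∷ x xs | last-∷ y ys | ∈-paths⁻ xs∈ | ∈-paths⁻ ys∈
  ... | z , l₁ | z′ , l₂ | (p₁ , _) | (p₂ , _)
    with trans (sym (ends-∷ x xs l₁)) (trans same-ends (ends-∷ y ys l₂))
  ... | refl with ≡-dec _≟ᶠ_ xs ys
  ...   | yes xs≡ys = cong (x ∷_) xs≡ys
  ...   | no xs≢ys  = ⊥-elim (acyclic (twoPaths⇒cycle G x xs ys p₁ l₁ p₂ l₂ xs≢ys))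

  acyclic⇒pn≤ : ¬ HasCycle G → pn G ≤ suc n C 2
  acyclic⇒pn≤ acyclic =
    subst₂ _≤_ (length-map ends paths) (trans (length-map just (orderedPairs n)) (length-orderedPairs n))
    (Unique-⊆⇒length≤ (Unique-map⁺-on ends Unique-paths (acyclic⇒ends-injective acyclic)) ends∈)
    where
    ends∈ : map ends paths ⊆ map just (orderedPairs n)
    ends∈ e∈ with ∈-map⁻ ends e∈
    ... | xs , xs∈ , refl with ends-paths xs∈
    ...   | e , eq , e∈ = subst (_∈ map just (orderedPairs n)) (sym eq) (∈-map⁺ just e∈)

  canonicalize-∈paths : ∀ {xs} → IsPath G xs → 2 ≤ length xs → canonicalize xs ∈ paths
  canonicalize-∈paths {xs} p@(u , l) len with canonicalᵇ xs in k
  ... | true  = ∈-paths⁺ p k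
  ... | false = ∈-paths⁺ (Unique-reverse u , Linked-reverse (Adj-sym G) l) (trans (canonicalᵇ-reverse u len) (cong not k))

  -- The two arcs of a cycle between a and its neighbour z, the long way round and the edge az.
  cycle⇒twoPaths : HasCycle G → Σ (List (Fin n)) λ P → Σ (List (Fin n)) λ Q →
                   P ∈ paths × Q ∈ paths × ends P ≡ ends Q × P ≢ Q
  cycle⇒twoPaths (a , b , c , rest , z , d , ch , l , za) =
    canonicalize long , canonicalize edge ,
    canonicalize-∈paths long-path (s≤s (s≤s z≤n)) , canonicalize-∈paths edge-path (s≤s (s≤s z≤n)) ,
    ends-canonicalize long edge (trans (canonicalᵇ-∷∷ a b (c ∷ rest) l) (sym (canonicalᵇ-∷∷ a z [] refl)))
      (ends-∷ a (b ∷ c ∷ rest) l) refl ,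
    λ eq → case trans (sym (length-canonicalize long)) (trans (cong length eq) (length-canonicalize edge)) of λ ()
    where
    long = a ∷ b ∷ c ∷ rest
    edge = a ∷ z ∷ []
    long-path : IsPath G long
    long-path = distinctᵇ⇒Unique long d , chainᵇ⇒Linked G long ch
    edge-path : IsPath G edge
    edge-path = ((head≢last (proj₁ long-path) l ∷ []) ∷ [] ∷ []) , Adj-sym G za ∷ [-]

module _ {n : ℕ} (G : Graph n) (conn : Connected G) where

  chosenPath : Fin n × Fin n → List (Fin n)
  chosenPath (u , v) = u ∷ Path.inner (walk⇒path G (conn u v))

  ends-chosenPath : ∀ e → ends (chosenPath e) ≡ just e
  ends-chosenPath (u , v) = ends-∷ u (Path.inner path) (Path.to path)
    where path = walk⇒path G (conn u v)

  chosenPath-injective : ∀ {e e′} → chosenPath e ≡ chosenPath e′ → e ≡ e′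
  chosenPath-injective {e} {e′} eq =
    just-injective (trans (sym (ends-chosenPath e)) (trans (cong ends eq) (ends-chosenPath e′)))

  chosenPaths : List (List (Fin n))
  chosenPaths = map chosenPath (orderedPairs n)

  chosenPaths⊆paths : chosenPaths ⊆ paths G
  chosenPaths⊆paths P∈ with ∈-map⁻ chosenPath P∈
  ... | (u , v) , uv∈ , refl with walk⇒path G (conn u v)
  ...   | record { inner = R ; isPath = p ; to = to } =
    ∈-paths⁺ G p (Equivalence.from (canonicalᵇ⇔≤ u R (proj₁ p) to) (∈-orderedPairs⁻ n uv∈))

  connected⇒pn≥ : suc n C 2 ≤ pn G
  connected⇒pn≥ = subst (_≤ pn G) (trans (length-map chosenPath (orderedPairs n)) (length-orderedPairs n))
    (Unique-⊆⇒length≤ (Unique.map⁺ chosenPath-injective (Unique-orderedPairs n)) chosenPaths⊆paths)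

  extraPath⇒pn> : ∀ {R} → R ∈ paths G → R ∉ chosenPaths → suc n C 2 < pn G
  extraPath⇒pn> {R} R∈ R∉ = subst (_≤ pn G) length-extended (Unique-⊆⇒length≤ unique extended⊆paths)
    where
    unique : Unique (chosenPaths ++ [ R ])
    unique = Unique.++⁺ (Unique.map⁺ chosenPath-injective (Unique-orderedPairs n)) ([] ∷ [])
                        λ { (R∈′ , here refl) → R∉ R∈′ }
    extended⊆paths : chosenPaths ++ [ R ] ⊆ paths G
    extended⊆paths P∈ with ∈-++⁻ chosenPaths P∈
    ... | inj₁ P∈chosen  = chosenPaths⊆paths P∈chosen
    ... | inj₂ (here refl) = R∈
    length-extended : length (chosenPaths ++ [ R ]) ≡ suc (suc n C 2)
    length-extended = begin
      length (chosenPaths ++ [ R ])  ≡⟨ length-++ chosenPaths ⟩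
      length chosenPaths + 1         ≡⟨ +-comm (length chosenPaths) 1 ⟩
      suc (length chosenPaths)       ≡⟨ cong suc (trans (length-map chosenPath (orderedPairs n)) (length-orderedPairs n)) ⟩
      suc (suc n C 2)                ∎
      where open ≡-Reasoning

  ∉chosenPaths : ∀ S {e} → ends S ≡ just e → S ≢ chosenPath e → S ∉ chosenPaths
  ∉chosenPaths S ends-S S≢ S∈ with ∈-map⁻ chosenPath S∈
  ... | e′ , _ , refl with just-injective (trans (sym ends-S) (ends-chosenPath e′))
  ...   | refl = S≢ refl

  cycle⇒pn> : HasCycle G → suc n C 2 < pn G
  cycle⇒pn> cycle with cycle⇒twoPaths G cycle
  ... | P , Q , P∈ , Q∈ , same-ends , P≢Q with ends-paths G P∈
  ...   | e , ends-P , _ with ≡-dec _≟ᶠ_ P (chosenPath e)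
  ...     | no P≢chosen = extraPath⇒pn> P∈ (∉chosenPaths P ends-P P≢chosen)
  ...     | yes P≡chosen =
    extraPath⇒pn> Q∈ (∉chosenPaths Q (trans (sym same-ends) ends-P) λ Q≡ → P≢Q (trans P≡chosen (sym Q≡)))


-- Spanning subgraphs and the complete graph

module _ {n : ℕ} where

  Adj⇒≢ : ∀ (G : Graph n) {u v} → Adj G u v → u ≢ v
  Adj⇒≢ G a refl = not-¬ a (adj-irrefl G _)

  isPathᵇ-mono : ∀ {G H : Graph n} → G ⊆ᴳ H →
                 ∀ xs → isPathᵇ G xs ≡ true → isPathᵇ H xs ≡ true
  isPathᵇ-mono G⊆H xs e with isPathᵇ⇒ _ xs e
  ... | (u , l) , k = isPathᵇ⇐ _ (u , Linked.map G⊆H l) k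

  pn≡countᵇ : ∀ (G : Graph n) → pn G ≡ countᵇ (isPathᵇ G) (candidates n)
  pn≡countᵇ G = length-filter≡countᵇ (isPathᵇ G) (candidates n)

  pn-mono : ∀ {G H : Graph n} → G ⊆ᴳ H → pn G ≤ pn H
  pn-mono {G} {H} G⊆H =
    subst₂ _≤_ (sym (pn≡countᵇ G)) (sym (pn≡countᵇ H)) (countᵇ-mono (isPathᵇ-mono G⊆H) (candidates n))

  pn-mono-<-ordered : ∀ {G H : Graph n} → G ⊆ᴳ H →
                      ∀ {u v} → Adj H u v → ¬ Adj G u v → toℕ u < toℕ v → pn G < pn H
  pn-mono-<-ordered {G} {H} G⊆H {u} {v} a ¬a u<v =
    subst₂ _<_ (sym (pn≡countᵇ G)) (sym (pn≡countᵇ H))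
      (countᵇ-mono-< (isPathᵇ-mono G⊆H) (candidates n) (∈-candidates u [ v ] (Unique⇒length≤ unique))
         (¬-not (λ e → ¬a (Linked.head (proj₂ (proj₁ (isPathᵇ⇒ G edge e))))))
         (isPathᵇ⇐ H (unique , a ∷ [-]) (Equivalence.from (canonicalᵇ⇔≤ u [ v ] unique refl) (<⇒≤ u<v))))
    where
    edge = u ∷ v ∷ []
    unique : Unique edge
    unique = (Adj⇒≢ H a ∷ []) ∷ [] ∷ []

  pn-mono-< : ∀ {G H : Graph n} → G ⊆ᴳ H →
              ∀ {u v} → Adj H u v → ¬ Adj G u v → pn G < pn H
  pn-mono-< {G} {H} G⊆H {u} {v} a ¬a with <-cmp (toℕ u) (toℕ v)
  ... | tri< u<v _ _ = pn-mono-<-ordered G⊆H a ¬a u<v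
  ... | tri≈ _ u≡v _ = ⊥-elim (Adj⇒≢ H a (toℕ-injective u≡v))
  ... | tri> _ _ v<u = pn-mono-<-ordered G⊆H (Adj-sym H a) (λ a′ → ¬a (Adj-sym G a′)) v<u

K : (n : ℕ) → Graph n
K n = record
  { adj    = λ u v → not (does (u ≟ᶠ v))
  ; sym    = λ u v → cong not (dec-does-sym u v)
  ; irrefl = λ v → cong not (dec-true (v ≟ᶠ v) refl)
  }
  where
  dec-does-sym : ∀ (u v : Fin n) → does (u ≟ᶠ v) ≡ does (v ≟ᶠ u)
  dec-does-sym u v with u ≟ᶠ v | v ≟ᶠ u
  ... | yes _    | yes _    = refl
  ... | no _     | no _     = refl
  ... | yes refl | no v≢u   = ⊥-elim (v≢u refl)
  ... | no u≢v   | yes refl = ⊥-elim (u≢v refl)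

module _ {n : ℕ} where

  ≢⇒Adj-K : ∀ {u v : Fin n} → u ≢ v → Adj (K n) u v
  ≢⇒Adj-K {u} {v} u≢v = cong not (dec-false (u ≟ᶠ v) u≢v)

  Unique⇒Linked-K : ∀ {xs : List (Fin n)} → Unique xs → Linked (Adj (K n)) xs
  Unique⇒Linked-K {[]}         _              = []
  Unique⇒Linked-K {x ∷ []}     _              = [-]
  Unique⇒Linked-K {x ∷ y ∷ ys} ((x≢y ∷ _) ∷ u) = ≢⇒Adj-K x≢y ∷ Unique⇒Linked-K u

  ⊆ᴳ-K : ∀ (G : Graph n) → G ⊆ᴳ K n
  ⊆ᴳ-K G a = ≢⇒Adj-K (Adj⇒≢ G a)

  pn≤pn-K : ∀ (G : Graph n) → pn G ≤ pn (K n)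
  pn≤pn-K G = pn-mono {G = G} {H = K n} (⊆ᴳ-K G)

  complete⇒pn≡pn-K : ∀ (G : Graph n) → IsComplete G → pn G ≡ pn (K n)
  complete⇒pn≡pn-K G complete =
    ≤-antisym (pn≤pn-K G) (pn-mono {G = K n} {H = G} λ {u} {v} a → complete u v (Adj⇒≢ (K n) a))

  pn≡pn-K⇒complete : ∀ (G : Graph n) → pn G ≡ pn (K n) → IsComplete G
  pn≡pn-K⇒complete G pn≡ u v u≢v with adj G u v in e
  ... | true  = refl
  ... | false = ⊥-elim (<-irrefl pn≡ (pn-mono-< {G = G} {H = K n} (⊆ᴳ-K G) (≢⇒Adj-K u≢v) λ a → not-¬ a e))


-- Counting the paths of Kₙ

module _ {n : ℕ} where

  distinctᵇ-reverse : ∀ (xs : List (Fin n)) → distinctᵇ (reverse xs) ≡ distinctᵇ xs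
  distinctᵇ-reverse xs with distinctᵇ xs in d
  ... | true  = Unique⇒distinctᵇ (Unique-reverse (distinctᵇ⇒Unique xs d))
  ... | false = ¬-not λ e → not-¬ (Unique⇒distinctᵇ (subst Unique (reverse-involutive xs)
                                      (Unique-reverse (distinctᵇ⇒Unique (reverse xs) e)))) d

  isPathᵇ-K : ∀ xs → isPathᵇ (K n) xs ≡ distinctᵇ xs ∧ canonicalᵇ xs
  isPathᵇ-K xs with distinctᵇ xs in d
  ... | true  rewrite Linked⇒chainᵇ (K n) (Unique⇒Linked-K (distinctᵇ⇒Unique xs d)) = refl
  ... | false = refl

module _ (n : ℕ) where

  arrangements : ℕ → ℕ
  arrangements m = countᵇ distinctᵇ (seqs n m)

  pathCount : ℕ → ℕ
  pathCount m = countᵇ (λ xs → distinctᵇ xs ∧ canonicalᵇ xs) (seqs n m)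

  pn-K≡∑ : pn (K n) ≡ ∑[ k < n ] pathCount (suc k)
  pn-K≡∑ = begin
    pn (K n)                                          ≡⟨ pn≡countᵇ (K n) ⟩
    countᵇ (isPathᵇ (K n)) (candidates n)             ≡⟨ countᵇ-cong (candidates n) (λ xs _ → isPathᵇ-K xs) ⟩
    countᵇ (λ xs → distinctᵇ xs ∧ canonicalᵇ xs) (candidates n)
      ≡⟨ ∑-concatMap (λ k → seqs n (suc k)) (upTo n) _ ⟩
    ∑[ k ∈ upTo n ] pathCount (suc k)                 ≡⟨ ∑-upTo n (λ k → pathCount (suc k)) ⟩
    ∑[ k < n ] pathCount (suc k)                      ∎
    where open ≡-Reasoning

  pathCount-1 : pathCount 1 ≡ n
  pathCount-1 = trans (∑-concatMap (λ x → map (x ∷_) ([] ∷ [])) (allFin n) _)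
                      (trans (∑-const (allFin n) 1) (trans (*-identityʳ _) (length-tabulate {n = n} (λ i → i))))

  countᵇ-elemᵇ : ∀ {s : List (Fin n)} → Unique s → countᵇ (λ x → elemᵇ x s) (allFin n) ≡ length s
  countᵇ-elemᵇ {s} u = trans (sym (length-filter≡countᵇ (λ x → elemᵇ x s) (allFin n)))
    (≤-antisym (Unique-⊆⇒length≤ (Unique.filter⁺ P? (Unique.allFin⁺ n))
                                 (λ x∈ → elemᵇ⇒∈ s (proj₂ (∈-filter⁻ P? {xs = allFin n} x∈))))
               (Unique-⊆⇒length≤ u (λ {x} x∈s → ∈-filter⁺ P? (∈-allFin x) (∈⇒elemᵇ x∈s))))
    where P? = λ x → elemᵇ x s ≟ᵇ true

  distinct-extensions : ∀ m {s} → s ∈ seqs n m →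
                        ∑[ x ∈ allFin n ] 𝟙 (distinctᵇ (x ∷ s)) ≡ 𝟙 (distinctᵇ s) * (n ∸ m)
  distinct-extensions m {s} s∈ with distinctᵇ s in d
  ... | false = trans (∑-cong (allFin n) (λ x _ → cong 𝟙 (∧-zeroʳ (not (elemᵇ x s)))))
                      (trans (∑-const (allFin n) 0) (*-zeroʳ (length (allFin n))))
  ... | true  = begin
    ∑[ x ∈ allFin n ] 𝟙 (not (elemᵇ x s) ∧ true)  ≡⟨ ∑-cong (allFin n) (λ x _ → cong 𝟙 (∧-identityʳ _)) ⟩
    fresh                                         ≡⟨ m+n∸n≡m fresh used ⟨
    fresh + used ∸ used                           ≡⟨ cong₂ _∸_ all-vertices used≡m ⟩
    n ∸ m                                         ≡⟨ +-identityʳ (n ∸ m) ⟨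
    1 * (n ∸ m)                                   ∎
    where
    open ≡-Reasoning
    fresh = countᵇ (λ x → not (elemᵇ x s)) (allFin n)
    used  = countᵇ (λ x → elemᵇ x s) (allFin n)
    all-vertices : fresh + used ≡ n
    all-vertices = trans (countᵇ-not (λ x → elemᵇ x s) (allFin n)) (length-tabulate {n = n} (λ i → i))
    used≡m : used ≡ m
    used≡m = trans (countᵇ-elemᵇ (distinctᵇ⇒Unique s d)) (∈-seqs⇒length m s∈)

  arrangements-suc : ∀ m → arrangements (suc m) ≡ arrangements m * (n ∸ m)
  arrangements-suc m = begin
    arrangements (suc m)
      ≡⟨ ∑-concatMap (λ x → map (x ∷_) S) (allFin n) _ ⟩
    ∑[ x ∈ allFin n ] countᵇ distinctᵇ (map (x ∷_) S)
      ≡⟨ ∑-cong (allFin n) (λ x _ → ∑-map (x ∷_) S _) ⟩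
    ∑[ x ∈ allFin n ] ∑[ s ∈ S ] 𝟙 (distinctᵇ (x ∷ s))
      ≡⟨ ∑-comm (allFin n) S _ ⟩
    ∑[ s ∈ S ] ∑[ x ∈ allFin n ] 𝟙 (distinctᵇ (x ∷ s))
      ≡⟨ ∑-cong S (λ s s∈ → distinct-extensions m s∈) ⟩
    ∑[ s ∈ S ] (𝟙 (distinctᵇ s) * (n ∸ m))
      ≡⟨ ∑-*ʳ S _ (n ∸ m) ⟩
    arrangements m * (n ∸ m) ∎
    where
    open ≡-Reasoning
    S = seqs n m

  arrangements*! : ∀ m → m ≤ n → arrangements m * (n ∸ m) ! ≡ n !
  arrangements*! zero    _   = +-identityʳ (n !)
  arrangements*! (suc m) m<n = begin
    arrangements (suc m) * (n ∸ suc m) !        ≡⟨ cong (_* (n ∸ suc m) !) (arrangements-suc m) ⟩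
    arrangements m * (n ∸ m) * (n ∸ suc m) !    ≡⟨ *-assoc (arrangements m) (n ∸ m) ((n ∸ suc m) !) ⟩
    arrangements m * ((n ∸ m) * (n ∸ suc m) !)  ≡⟨ cong (arrangements m *_) !-unfold ⟩
    arrangements m * (n ∸ m) !                  ≡⟨ arrangements*! m (<⇒≤ m<n) ⟩
    n !                                         ∎
    where
    open ≡-Reasoning
    n∸m≡1+n∸[1+m] : n ∸ m ≡ suc (n ∸ suc m)
    n∸m≡1+n∸[1+m] = +-∸-assoc 1 m<n
    !-unfold : (n ∸ m) * (n ∸ suc m) ! ≡ (n ∸ m) !
    !-unfold rewrite n∸m≡1+n∸[1+m] = refl

  -- A sequence of at least two distinct vertices and its reverse span the same path; exactly one is canonical.
  arrangements≡2*pathCount : ∀ m → arrangements (suc (suc m)) ≡ pathCount (suc (suc m)) + pathCount (suc (suc m))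
  arrangements≡2*pathCount m = begin
    arrangements (suc (suc m))
      ≡⟨ countᵇ-split distinctᵇ canonicalᵇ S ⟩
    pathCount (suc (suc m)) + countᵇ (λ xs → distinctᵇ xs ∧ not (canonicalᵇ xs)) S
      ≡⟨ cong (_+_ (pathCount (suc (suc m)))) (countᵇ-cong S reversed) ⟩
    pathCount (suc (suc m)) + countᵇ (λ xs → isCanonicalDistinct (reverse xs)) S
      ≡⟨ cong (_+_ (pathCount (suc (suc m))))
              (countᵇ-∘-involution reverse reverse-involutive (Unique-seqs (suc (suc m)))
                                   (∈-seqs-reverse (suc (suc m))) isCanonicalDistinct) ⟩
    pathCount (suc (suc m)) + pathCount (suc (suc m)) ∎
    where
    open ≡-Reasoning
    S = seqs n (suc (suc m))
    isCanonicalDistinct : List (Fin n) → Bool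
    isCanonicalDistinct xs = distinctᵇ xs ∧ canonicalᵇ xs
    reversed : ∀ xs → xs ∈ S → distinctᵇ xs ∧ not (canonicalᵇ xs) ≡ isCanonicalDistinct (reverse xs)
    reversed xs xs∈ with distinctᵇ xs in d
    ... | false = sym (cong (_∧ canonicalᵇ (reverse xs)) (trans (distinctᵇ-reverse xs) d))
    ... | true  = sym (cong₂ _∧_ (trans (distinctᵇ-reverse xs) d)
                    (canonicalᵇ-reverse (distinctᵇ⇒Unique xs d)
                       (subst (2 ≤_) (sym (∈-seqs⇒length (suc (suc m)) xs∈)) (s≤s (s≤s z≤n)))))

  2*∑pathCount : ∀ m → 2 * ∑[ k < suc m ] pathCount (suc k) ≡ n + ∑[ k < suc m ] arrangements (suc k)
  2*∑pathCount zero rewrite pathCount-1 | arrangements-suc 0 = refl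
  2*∑pathCount (suc m) = begin
    2 * (P + pathCount (suc (suc m)))                        ≡⟨ *-distribˡ-+ 2 P _ ⟩
    2 * P + 2 * pathCount (suc (suc m))
      ≡⟨ cong₂ _+_ (2*∑pathCount m) (cong (_+_ (pathCount (suc (suc m)))) (+-identityʳ _)) ⟩
    n + ∑[ k < suc m ] arrangements (suc k) + (pathCount (suc (suc m)) + pathCount (suc (suc m)))
      ≡⟨ cong (_+_ (n + ∑[ k < suc m ] arrangements (suc k))) (sym (arrangements≡2*pathCount m)) ⟩
    n + ∑[ k < suc m ] arrangements (suc k) + arrangements (suc (suc m)) ≡⟨ +-assoc n _ _ ⟩
    n + ∑[ k < suc (suc m) ] arrangements (suc k)           ∎
    where
    open ≡-Reasoning
    P = ∑[ k < suc m ] pathCount (suc k)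

2*pn-K : ∀ n → 1 ≤ n → 2 * pn (K n) ≡ n + ∑[ k < n ] arrangements n (suc k)
2*pn-K (suc j) _ = trans (cong (2 *_) (pn-K≡∑ (suc j))) (2*∑pathCount (suc j) j)


-- The value of the upper bound

ι : ℕ → ℚ
ι a = + a / 1

toℚᵘ-/ : ∀ i d → toℚᵘ (i / suc d) ≃ᵘ mkℚᵘ i d
toℚᵘ-/ i d = ℚₚ.toℚᵘ-fromℚᵘ (mkℚᵘ i d)

ι-+ : ∀ a b → ι (a + b) ≡ ι a ℚ.+ ι b
ι-+ a b = ℚₚ.toℚᵘ-injective (begin
  toℚᵘ (ι (a + b))                ≈⟨ toℚᵘ-/ (+ (a + b)) 0 ⟩
  mkℚᵘ (+ (a + b)) 0              ≈⟨ *≡* cross-multiplied ⟩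
  mkℚᵘ (+ a) 0 ℚᵘ.+ mkℚᵘ (+ b) 0  ≈⟨ ℚᵘₚ.+-cong (toℚᵘ-/ (+ a) 0) (toℚᵘ-/ (+ b) 0) ⟨
  toℚᵘ (ι a) ℚᵘ.+ toℚᵘ (ι b)      ≈⟨ ℚₚ.toℚᵘ-homo-+ (ι a) (ι b) ⟨
  toℚᵘ (ι a ℚ.+ ι b)              ∎)
  where
  open ℚᵘₚ.≃-Reasoning
  open ℤ-Solver.+-*-Solver using (solve; _:+_; _:*_; _:=_; con)
  cross-multiplied : + (a + b) ℤ.* + 1 ≡ (+ a ℤ.* + 1 ℤ.+ + b ℤ.* + 1) ℤ.* + 1
  cross-multiplied = trans (cong (ℤ._* + 1) (ℤₚ.pos-+ a b))
    (solve 2 (λ x y → (x :+ y) :* con (+ 1) := (x :* con (+ 1) :+ y :* con (+ 1)) :* con (+ 1)) refl (+ a) (+ b))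

ι-* : ∀ a b → ι (a * b) ≡ ι a ℚ.* ι b
ι-* a b = ℚₚ.toℚᵘ-injective (begin
  toℚᵘ (ι (a * b))                ≈⟨ toℚᵘ-/ (+ (a * b)) 0 ⟩
  mkℚᵘ (+ (a * b)) 0              ≈⟨ *≡* (cong (ℤ._* + 1) (ℤₚ.pos-* a b)) ⟩
  mkℚᵘ (+ a) 0 ℚᵘ.* mkℚᵘ (+ b) 0  ≈⟨ ℚᵘₚ.*-cong (toℚᵘ-/ (+ a) 0) (toℚᵘ-/ (+ b) 0) ⟨
  toℚᵘ (ι a) ℚᵘ.* toℚᵘ (ι b)      ≈⟨ ℚₚ.toℚᵘ-homo-* (ι a) (ι b) ⟨
  toℚᵘ (ι a ℚ.* ι b)              ∎)
  where open ℚᵘₚ.≃-Reasoning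

/≡ι*1/ : ∀ a d .{{_ : NonZero d}} → + a / d ≡ ι a ℚ.* (+ 1 / d)
/≡ι*1/ a (suc d) = ℚₚ.toℚᵘ-injective (begin
  toℚᵘ (+ a / suc d)                   ≈⟨ toℚᵘ-/ (+ a) d ⟩
  mkℚᵘ (+ a) d                         ≈⟨ *≡* cross-multiplied ⟩
  mkℚᵘ (+ a) 0 ℚᵘ.* mkℚᵘ (+ 1) d       ≈⟨ ℚᵘₚ.*-cong (toℚᵘ-/ (+ a) 0) (toℚᵘ-/ (+ 1) d) ⟨
  toℚᵘ (ι a) ℚᵘ.* toℚᵘ (+ 1 / suc d)   ≈⟨ ℚₚ.toℚᵘ-homo-* (ι a) (+ 1 / suc d) ⟨
  toℚᵘ (ι a ℚ.* (+ 1 / suc d))         ∎)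
  where
  open ℚᵘₚ.≃-Reasoning
  open ℤ-Solver.+-*-Solver using (solve; _:*_; _:=_; con)
  cross-multiplied : + a ℤ.* + (1 * suc d) ≡ (+ a ℤ.* + 1) ℤ.* + suc d
  cross-multiplied = trans (cong (λ m → + a ℤ.* + m) (*-identityˡ (suc d)))
                           (solve 2 (λ x y → x :* y := (x :* con (+ 1)) :* y) refl (+ a) (+ suc d))

ι*1/≡1 : ∀ d .{{_ : NonZero d}} → ι d ℚ.* (+ 1 / d) ≡ 1ℚ
ι*1/≡1 (suc d) = ℚₚ.toℚᵘ-injective (begin
  toℚᵘ (ι (suc d) ℚ.* (+ 1 / suc d))          ≈⟨ ℚₚ.toℚᵘ-homo-* (ι (suc d)) (+ 1 / suc d) ⟩
  toℚᵘ (ι (suc d)) ℚᵘ.* toℚᵘ (+ 1 / suc d)   ≈⟨ ℚᵘₚ.*-cong (toℚᵘ-/ (+ suc d) 0) (toℚᵘ-/ (+ 1) d) ⟩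
  mkℚᵘ (+ suc d) 0 ℚᵘ.* mkℚᵘ (+ 1) d          ≈⟨ *≡* cross-multiplied ⟩
  toℚᵘ 1ℚ                                     ∎)
  where
  open ℚᵘₚ.≃-Reasoning
  open ℤ-Solver.+-*-Solver using (solve; _:*_; _:=_; con)
  cross-multiplied : (+ suc d ℤ.* + 1) ℤ.* + 1 ≡ + 1 ℤ.* + (1 * suc d)
  cross-multiplied = trans (solve 1 (λ x → (x :* con (+ 1)) :* con (+ 1) := con (+ 1) :* x) refl (+ suc d))
                           (cong (λ m → + 1 ℤ.* + m) (sym (*-identityˡ (suc d))))

ι-mono-≤ : ∀ {a b} → a ≤ b → ι a ≤ℚ ι b
ι-mono-≤ {a} {b} a≤b = ℚₚ.toℚᵘ-cancel-≤
  (ℚᵘₚ.≤-respˡ-≃ (ℚᵘₚ.≃-sym (toℚᵘ-/ (+ a) 0)) (ℚᵘₚ.≤-respʳ-≃ (ℚᵘₚ.≃-sym (toℚᵘ-/ (+ b) 0))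
    (*≤* (subst₂ ℤ._≤_ (sym (ℤₚ.*-identityʳ (+ a))) (sym (ℤₚ.*-identityʳ (+ b))) (ℤ.+≤+ a≤b)))))

ι-injective : ∀ {a b} → ι a ≡ ι b → a ≡ b
ι-injective {a} {b} eq
  with ℚᵘₚ.≃-trans (ℚᵘₚ.≃-sym (toℚᵘ-/ (+ a) 0)) (ℚᵘₚ.≃-trans (ℚₚ.toℚᵘ-cong eq) (toℚᵘ-/ (+ b) 0))
... | *≡* a*1≡b*1 = ℤₚ.+-injective (trans (sym (ℤₚ.*-identityʳ (+ a))) (trans a*1≡b*1 (ℤₚ.*-identityʳ (+ b))))

-- Term i of n!·Σ 1/i! is n!/i! = arrangements n (n ∸ i).
n!*invFactSum : ∀ n m → m ≤ n → ι (n !) ℚ.* invFactSum m ≡ ι (∑[ i < m ] arrangements n (n ∸ i))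
n!*invFactSum n zero    _   = ℚₚ.*-zeroʳ (ι (n !))
n!*invFactSum n (suc m) m<n = begin
  ι (n !) ℚ.* (invFactSum m ℚ.+ 1/m!)                 ≡⟨ ℚₚ.*-distribˡ-+ (ι (n !)) (invFactSum m) 1/m! ⟩
  ι (n !) ℚ.* invFactSum m ℚ.+ ι (n !) ℚ.* 1/m!       ≡⟨ cong₂ ℚ._+_ (n!*invFactSum n m (<⇒≤ m<n)) last-term ⟩
  ι (∑[ i < m ] A (n ∸ i)) ℚ.+ ι (A (n ∸ m))         ≡⟨ ι-+ (∑[ i < m ] A (n ∸ i)) (A (n ∸ m)) ⟨
  ι (∑[ i < suc m ] A (n ∸ i))                        ∎
  where
  open ≡-Reasoning
  A = arrangements n
  1/m! = (+ 1 / m !) {{m !≢0}}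
  n!≡ : n ! ≡ A (n ∸ m) * m !
  n!≡ = trans (sym (arrangements*! n (n ∸ m) (m∸n≤m n m))) (cong (λ k → A (n ∸ m) * k !) (m∸[m∸n]≡n (<⇒≤ m<n)))
  last-term : ι (n !) ℚ.* 1/m! ≡ ι (A (n ∸ m))
  last-term = begin
    ι (n !) ℚ.* 1/m!                     ≡⟨ cong (λ k → ι k ℚ.* 1/m!) n!≡ ⟩
    ι (A (n ∸ m) * m !) ℚ.* 1/m!         ≡⟨ cong (ℚ._* 1/m!) (ι-* (A (n ∸ m)) (m !)) ⟩
    ι (A (n ∸ m)) ℚ.* ι (m !) ℚ.* 1/m!   ≡⟨ ℚₚ.*-assoc (ι (A (n ∸ m))) (ι (m !)) 1/m! ⟩
    ι (A (n ∸ m)) ℚ.* (ι (m !) ℚ.* 1/m!) ≡⟨ cong (ι (A (n ∸ m)) ℚ.*_) (ι*1/≡1 (m !) {{m !≢0}}) ⟩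
    ι (A (n ∸ m)) ℚ.* 1ℚ                 ≡⟨ ℚₚ.*-identityʳ _ ⟩
    ι (A (n ∸ m))                        ∎

ι-pn-K : ∀ n → 1 ≤ n → ι (pn (K n)) ≡ upperBound n
ι-pn-K n 1≤n = sym (begin
  (+ (n !) / 2) ℚ.* invFactSum n ℚ.+ (+ n / 2)
    ≡⟨ cong₂ (λ p q → p ℚ.* invFactSum n ℚ.+ q) (/≡ι*1/ (n !) 2) (/≡ι*1/ n 2) ⟩
  ι (n !) ℚ.* ½ ℚ.* invFactSum n ℚ.+ ι n ℚ.* ½
    ≡⟨ solve 4 (λ f h s m → f :* h :* s :+ m :* h := h :* (f :* s :+ m)) refl (ι (n !)) ½ (invFactSum n) (ι n) ⟩
  ½ ℚ.* (ι (n !) ℚ.* invFactSum n ℚ.+ ι n)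
    ≡⟨ cong (λ q → ½ ℚ.* (q ℚ.+ ι n)) (n!*invFactSum n n ≤-refl) ⟩
  ½ ℚ.* (ι T ℚ.+ ι n)
    ≡⟨ cong (½ ℚ.*_) (ι-+ T n) ⟨
  ½ ℚ.* ι (T + n)
    ≡⟨ cong (λ k → ½ ℚ.* ι k) T+n≡2*pn ⟩
  ½ ℚ.* ι (2 * pn (K n))
    ≡⟨ cong (½ ℚ.*_) (ι-* 2 (pn (K n))) ⟩
  ½ ℚ.* (ι 2 ℚ.* ι (pn (K n)))
    ≡⟨ ℚₚ.*-assoc ½ (ι 2) (ι (pn (K n))) ⟨
  ½ ℚ.* ι 2 ℚ.* ι (pn (K n))
    ≡⟨ cong (ℚ._* ι (pn (K n))) (trans (ℚₚ.*-comm ½ (ι 2)) (ι*1/≡1 2)) ⟩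
  1ℚ ℚ.* ι (pn (K n))
    ≡⟨ ℚₚ.*-identityˡ (ι (pn (K n))) ⟩
  ι (pn (K n))
    ∎)
  where
  open ≡-Reasoning
  open ℚ-Solver.+-*-Solver using (solve; _:+_; _:*_; _:=_)
  ½ = + 1 / 2
  T = ∑[ i < n ] arrangements n (n ∸ i)
  T+n≡2*pn : T + n ≡ 2 * pn (K n)
  T+n≡2*pn = trans (cong (_+ n) (∑<-reflect n (arrangements n))) (trans (+-comm _ n) (sym (2*pn-K n 1≤n)))

mainTheorem1 : (n : ℕ) → 1 ≤ n → (G : Graph n) → Connected G →
    ((suc n) C 2 ≤ pn G) ×
    ((+ (pn G) / 1) ≤ℚ upperBound n) ×
    ((pn G ≡ (suc n) C 2) ⇔ IsTree G) ×
    (((+ (pn G) / 1) ≡ upperBound n) ⇔ IsComplete G)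
mainTheorem1 n 1≤n G connected =
  connected⇒pn≥ G connected ,
  subst (ι (pn G) ≤ℚ_) (ι-pn-K n 1≤n) (ι-mono-≤ (pn≤pn-K G)) ,
  mk⇔ (λ pn≡ → connected , λ cycle → <-irrefl (sym pn≡) (cycle⇒pn> G connected cycle))
      (λ (_ , acyclic) → ≤-antisym (acyclic⇒pn≤ G acyclic) (connected⇒pn≥ G connected)) ,
  mk⇔ (λ ι≡ → pn≡pn-K⇒complete G (ι-injective (trans ι≡ (sym (ι-pn-K n 1≤n)))))
      (λ complete → trans (cong ι (complete⇒pn≡pn-K G complete)) (ι-pn-K n 1≤n))
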